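{- Let $r\ge0$ be an integer and let $x^ay^bz^c$ (with $a,c\ge0$, $b\in\mathbb{Z}$) be a monomial occurring with nonzero coefficient in $(D^{(3)})^rx\in\mathbb{Q}[x,y,z,1/y]$. Put $\lambda=a-1$ and $\nu=-c$ (so that $b=\frac{ -\lambda+3\nu+r}{2}$). Then (a) $\nu\ge\frac23(\lambda-r)$; (b) $4b+3c\ge0$ and $b\ge-\frac{r+1}{2}$.
   Context: $D^{(3)}$ is the derivation of $\mathbb{Q}(x,y,z)$ given by $D^{(3)}f=\frac{x^2-y}{6}f_x+\frac{2(xy-z)}{3}f_y+\frac{2xz-y^2-z^2/y}{2}f_z$; it maps $\mathbb{Q}[x,y,z,1/y]$ into itself. $(D^{(3)})^r$ is its $r$-fold iterate. -}

module Defs where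

open import Data.Nat as ℕ using (ℕ; zero; suc)
open import Data.Integer as ℤ using (ℤ; +_)
open import Data.Rational as ℚ using (ℚ; 0ℚ; 1ℚ; _/_)
open import Data.List using (List; []; _∷_; _++_; concatMap)
open import Data.Product using (_×_; _,_)
open import Data.Bool using (if_then_else_; _∧_)
open import Relation.Nullary using (does)
import Data.Nat.Properties as ℕP
import Data.Integer.Properties as ℤP

record Term : Set where
  constructor term
  field
    coef : ℚ
    ex   : ℕ
    ey   : ℤ
    ez   : ℕ

-- An element of ℚ[x,y,z,1/y], represented as a finite formal sum of terms
-- (repeated monomials allowed; the element is the sum of the terms).
Poly : Set
Poly = List Term

coeff : Poly → ℕ → ℤ → ℕ → ℚ
coeff [] a b c = 0ℚ
coeff (term q a' b' c' ∷ p) a b c =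
  if does (a' ℕP.≟ a) ∧ does (b' ℤP.≟ b) ∧ does (c' ℕP.≟ c)
  then q ℚ.+ coeff p a b c
  else coeff p a b c

X : Poly
X = term 1ℚ 1 (+ 0) 0 ∷ []

ℕtoℚ : ℕ → ℚ
ℕtoℚ n = + n / 1

ℤtoℚ : ℤ → ℚ
ℤtoℚ n = n / 1

-- D^{(3)} applied to one term  q x^a y^b z^c :
--   (x²-y)/6 · f_x + 2(xy-z)/3 · f_y + (2xz - y² - z²/y)/2 · f_z
-- (when a = 0 or c = 0 the corresponding terms have coefficient 0).
D3-term : Term → Poly
D3-term (term q a b c) =
  let qa = q ℚ.* ℕtoℚ a
      qb = q ℚ.* ℤtoℚ b
      qc = q ℚ.* ℕtoℚ c
  in
  term (qa ℚ.* (+ 1 / 6))            (suc a)   b             c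
  ∷ term (ℚ.- (qa ℚ.* (+ 1 / 6)))    (a ℕ.∸ 1) (b ℤ.+ + 1)   c
  ∷ term (qb ℚ.* (+ 2 / 3))          (suc a)   b             c
  ∷ term (ℚ.- (qb ℚ.* (+ 2 / 3)))    a         (b ℤ.- + 1)   (suc c)
  ∷ term qc                          (suc a)   b             c
  ∷ term (ℚ.- (qc ℚ.* (+ 1 / 2)))    a         (b ℤ.+ + 2)   (c ℕ.∸ 1)
  ∷ term (ℚ.- (qc ℚ.* (+ 1 / 2)))    a         (b ℤ.- + 1)   (suc c)
  ∷ []

D3 : Poly → Poly
D3 = concatMap D3-term

D3^ : ℕ → Poly → Poly
D3^ zero    p = p
D3^ (suc r) p = D3 (D3^ r p)

-- Coefficientwise, D acts by a linear operator: the coefficient of a monomial m in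
-- D(p) is a weighted sum of the coefficients in p of the (at most four) monomials
-- that D sends to m. By induction on r, the support of Dʳx therefore lies among
-- the monomials of weighted degree a + 2b + 3c = r + 1 with 3ν − 2(λ − r) ≥ 0.
-- Every part of D raises the weighted degree by one and preserves the inequality,
-- except the terms −(2z/3)∂/∂y and −(z²/2y)∂/∂z (which lower b and raise c)
-- applied on the boundary 3ν = 2(λ − r). There the weighted degree forces
-- 4b + 3c = 0, and the combined weight −(4b + 3c)/6 of these two terms vanishes.
-- Parts (a) and (b) then follow linearly.
module Submission where

open import Defs
open import Data.Bool using (true; false; if_then_else_)
open import Data.Empty using (⊥-elim)
open import Data.Integer using (ℤ; +_; _+_; _-_; _*_; -_; _≤_; +≤+)
import Data.Integer.Properties as ℤP
open import Data.Integer.Tactic.RingSolver using (solve-∀)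
open import Data.List using ([]; _∷_; _++_; map; foldr)
open import Data.Maybe using (Maybe; just; nothing)
open import Data.Nat as ℕ using (ℕ; zero; suc; z≤n)
import Data.Nat.Properties as ℕP
open import Data.Product using (_×_; _,_; ∃-syntax)
open import Data.Rational as ℚ using (ℚ; 0ℚ; 1ℚ; _/_)
import Data.Rational.Properties as ℚP
open import Data.Rational.Unnormalised as ℚᵘ using (mkℚᵘ; *≡*)
import Data.Rational.Unnormalised.Properties as ℚᵘP
open import Data.Sum using (_⊎_; inj₁; inj₂)
open import Function using (_∘_; mk⇔)
open import Level using (0ℓ)
open import Relation.Binary.Definitions using (DecidableEquality)
open import Relation.Binary.PropositionalEquality
open import Relation.Nullary using (does; yes; no; _×-dec_)
open import Relation.Nullary.Decidable using (map′; dec⇒maybe; dec-true; dec-false; does-⇔)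
import Tactic.RingSolver as RingSolver
import Tactic.RingSolver.Core.AlmostCommutativeRing as ACR

ℚ-ring : ACR.AlmostCommutativeRing 0ℓ 0ℓ
ℚ-ring = ACR.fromCommutativeRing ℚP.+-*-commutativeRing (dec⇒maybe ∘ (0ℚ ℚP.≟_))

≡-modulo : ∀ {e f x y : ℤ} k → e ≡ f + k * (x - y) → x ≡ y → e ≡ f
≡-modulo {f = f} {x} k e≡ refl = trans e≡ (cancel f k x)
  where
  cancel : ∀ f k x → f + k * (x - x) ≡ f
  cancel = solve-∀

+-≢0 : ∀ {x y} → x ℚ.+ y ≢ 0ℚ → x ≢ 0ℚ ⊎ y ≢ 0ℚ
+-≢0 {x} {y} nz with x ℚP.≟ 0ℚ
... | no  x≢0  = inj₁ x≢0
... | yes refl = inj₂ (λ y≡0 → nz (trans (ℚP.+-identityˡ y) y≡0))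

ℤtoℚ-toℚᵘ : ∀ x → ℚ.toℚᵘ (ℤtoℚ x) ℚᵘ.≃ mkℚᵘ x 0
ℤtoℚ-toℚᵘ x = ℚP.toℚᵘ-fromℚᵘ (mkℚᵘ x 0)

module _ where
  open ℚᵘP.≃-Reasoning

  ℤtoℚ-+ : ∀ x y → ℤtoℚ (x + y) ≡ ℤtoℚ x ℚ.+ ℤtoℚ y
  ℤtoℚ-+ x y = ℚP.toℚᵘ-injective (begin
    ℚ.toℚᵘ (ℤtoℚ (x + y))               ≈⟨ ℤtoℚ-toℚᵘ (x + y) ⟩
    mkℚᵘ (x + y) 0                        ≈⟨ *≡* (eq x y) ⟩
    mkℚᵘ x 0 ℚᵘ.+ mkℚᵘ y 0                ≈⟨ ℚᵘP.+-cong (ℤtoℚ-toℚᵘ x) (ℤtoℚ-toℚᵘ y) ⟨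
    ℚ.toℚᵘ (ℤtoℚ x) ℚᵘ.+ ℚ.toℚᵘ (ℤtoℚ y)  ≈⟨ ℚP.toℚᵘ-homo-+ (ℤtoℚ x) (ℤtoℚ y) ⟨
    ℚ.toℚᵘ (ℤtoℚ x ℚ.+ ℤtoℚ y)            ∎)
    where
    eq : ∀ x y → (x + y) * + 1 ≡ (x * + 1 + y * + 1) * + 1
    eq = solve-∀

  ℤtoℚ-* : ∀ x y → ℤtoℚ (x * y) ≡ ℤtoℚ x ℚ.* ℤtoℚ y
  ℤtoℚ-* x y = ℚP.toℚᵘ-injective (begin
    ℚ.toℚᵘ (ℤtoℚ (x * y))               ≈⟨ ℤtoℚ-toℚᵘ (x * y) ⟩
    mkℚᵘ (x * y) 0                        ≈⟨ *≡* refl ⟩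
    mkℚᵘ x 0 ℚᵘ.* mkℚᵘ y 0                ≈⟨ ℚᵘP.*-cong (ℤtoℚ-toℚᵘ x) (ℤtoℚ-toℚᵘ y) ⟨
    ℚ.toℚᵘ (ℤtoℚ x) ℚᵘ.* ℚ.toℚᵘ (ℤtoℚ y)  ≈⟨ ℚP.toℚᵘ-homo-* (ℤtoℚ x) (ℤtoℚ y) ⟨
    ℚ.toℚᵘ (ℤtoℚ x ℚ.* ℤtoℚ y)            ∎)

Monomial : Set
Monomial = ℕ × ℤ × ℕ

-- Built from the same component tests as coeff, so that coeff unfolds into single.
_≟ᵐ_ : DecidableEquality Monomial
(a , b , c) ≟ᵐ (a′ , b′ , c′) =
  map′ (λ { (refl , refl , refl) → refl }) (λ { refl → refl , refl , refl })
       (a ℕP.≟ a′ ×-dec b ℤP.≟ b′ ×-dec c ℕP.≟ c′)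

monomial : Term → Monomial
monomial (term _ a b c) = a , b , c

coeffᵐ : Poly → Monomial → ℚ
coeffᵐ p (a , b , c) = coeff p a b c

single : Monomial → ℚ → Monomial → ℚ
single s q m = if does (s ≟ᵐ m) then q else 0ℚ

single-same : ∀ s q → single s q s ≡ q
single-same s q = cong (λ B → if B then q else 0ℚ) (dec-true (s ≟ᵐ s) refl)

single-other : ∀ {s m} q → s ≢ m → single s q m ≡ 0ℚ
single-other {s} {m} q s≢m = cong (λ B → if B then q else 0ℚ) (dec-false (s ≟ᵐ m) s≢m)

single-support : ∀ s q m → single s q m ≢ 0ℚ → s ≡ m
single-support s q m nz with s ≟ᵐ m
... | yes s≡m = s≡m
... | no  s≢m = ⊥-elim (nz (single-other q s≢m))

single-zero : ∀ s m → single s 0ℚ m ≡ 0ℚ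
single-zero s m with s ≟ᵐ m
... | yes refl = single-same s 0ℚ
... | no  s≢m  = single-other 0ℚ s≢m

single-+ : ∀ s x y m → single s x m ℚ.+ single s y m ≡ single s (x ℚ.+ y) m
single-+ s x y m with s ≟ᵐ m
... | yes refl = trans (cong₂ ℚ._+_ (single-same s x) (single-same s y)) (sym (single-same s (x ℚ.+ y)))
... | no  s≢m  = trans (cong₂ ℚ._+_ (single-other x s≢m) (single-other y s≢m)) (sym (single-other (x ℚ.+ y) s≢m))

single-scale : ∀ s q (w : Monomial → ℚ) m → single s (q ℚ.* w s) m ≡ single s q m ℚ.* w m
single-scale s q w m with s ≟ᵐ m
... | yes refl = trans (single-same s (q ℚ.* w s)) (cong (ℚ._* w s) (sym (single-same s q)))
... | no  s≢m  = begin
  single s (q ℚ.* w s) m   ≡⟨ single-other (q ℚ.* w s) s≢m ⟩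
  0ℚ                       ≡⟨ ℚP.*-zeroˡ (w m) ⟨
  0ℚ ℚ.* w m               ≡⟨ cong (ℚ._* w m) (single-other q s≢m) ⟨
  single s q m ℚ.* w m     ∎
  where open ≡-Reasoning

single-shiftʸ : ∀ a′ b′ c′ q a b c k →
  single (a′ , b′ + k , c′) q (a , b , c) ≡ single (a′ , b′ , c′) q (a , b - k , c)
single-shiftʸ a′ b′ c′ q a b c k =
  cong (λ B → if B then q else 0ℚ) (does-⇔ (mk⇔ to from) (_ ≟ᵐ _) (_ ≟ᵐ _))
  where
  cancel : ∀ x k → x + k - k ≡ x
  cancel = solve-∀
  restore : ∀ x k → x - k + k ≡ x
  restore = solve-∀
  to : (a′ , b′ + k , c′) ≡ (a , b , c) → (a′ , b′ , c′) ≡ (a , b - k , c)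
  to refl = cong (λ y → a′ , y , c′) (sym (cancel b′ k))
  from : (a′ , b′ , c′) ≡ (a , b - k , c) → (a′ , b′ + k , c′) ≡ (a , b , c)
  from refl = cong (λ y → a , y , c) (restore b k)

coeff-∷ : ∀ t p m → coeffᵐ (t ∷ p) m ≡ single (monomial t) (Term.coef t) m ℚ.+ coeffᵐ p m
coeff-∷ (term q a′ b′ c′) p (a , b , c) with does ((a′ , b′ , c′) ≟ᵐ (a , b , c))
... | true  = refl
... | false = sym (ℚP.+-identityˡ _)

coeff-++ : ∀ p p′ m → coeffᵐ (p ++ p′) m ≡ coeffᵐ p m ℚ.+ coeffᵐ p′ m
coeff-++ [] p′ (a , b , c) = sym (ℚP.+-identityˡ _)
coeff-++ (t ∷ p) p′ m = begin
  coeffᵐ (t ∷ p ++ p′) m                    ≡⟨ coeff-∷ t (p ++ p′) m ⟩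
  δ ℚ.+ coeffᵐ (p ++ p′) m                  ≡⟨ cong (δ ℚ.+_) (coeff-++ p p′ m) ⟩
  δ ℚ.+ (coeffᵐ p m ℚ.+ coeffᵐ p′ m)        ≡⟨ ℚP.+-assoc δ _ _ ⟨
  (δ ℚ.+ coeffᵐ p m) ℚ.+ coeffᵐ p′ m        ≡⟨ cong (ℚ._+ coeffᵐ p′ m) (coeff-∷ t p m) ⟨
  coeffᵐ (t ∷ p) m ℚ.+ coeffᵐ p′ m          ∎
  where
  open ≡-Reasoning
  δ = single (monomial t) (Term.coef t) m

coeff-sum : ∀ p m → coeffᵐ p m ≡ foldr ℚ._+_ 0ℚ (map (λ t → single (monomial t) (Term.coef t) m) p)
coeff-sum [] (a , b , c) = refl
coeff-sum (t ∷ p) m = trans (coeff-∷ t p m) (cong (single (monomial t) (Term.coef t) m ℚ.+_) (coeff-sum p m))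

data Move : Set where
  x↑ x↓ z↑ z↓ : Move

-- D3 sends q·s to Σₖ q·weight k s·target k s; source k is the inverse of
-- target k wherever weight k does not vanish (a = 0 for x↓, c = 0 for z↓).
target : Move → Monomial → Monomial
target x↑ (a , b , c) = suc a , b , c
target x↓ (a , b , c) = a ℕ.∸ 1 , b + + 1 , c
target z↑ (a , b , c) = a , b - + 1 , suc c
target z↓ (a , b , c) = a , b + + 2 , c ℕ.∸ 1

weight : Move → Monomial → ℚ
weight x↑ (a , b , c) = ℕtoℚ a ℚ.* (+ 1 / 6) ℚ.+ ℤtoℚ b ℚ.* (+ 2 / 3) ℚ.+ ℕtoℚ c
weight x↓ (a , _ , _) = ℚ.- (ℕtoℚ a ℚ.* (+ 1 / 6))
weight z↑ (_ , b , c) = ℚ.- (ℤtoℚ b ℚ.* (+ 2 / 3)) ℚ.+ ℚ.- (ℕtoℚ c ℚ.* (+ 1 / 2))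
weight z↓ (_ , _ , c) = ℚ.- (ℕtoℚ c ℚ.* (+ 1 / 2))

source : Move → Monomial → Maybe Monomial
source x↑ (zero  , b , c) = nothing
source x↑ (suc a , b , c) = just (a , b , c)
source x↓ (a , b , c)     = just (suc a , b - + 1 , c)
source z↑ (a , b , zero)  = nothing
source z↑ (a , b , suc c) = just (a , b + + 1 , c)
source z↓ (a , b , c)     = just (a , b - + 2 , suc c)

pullFrom : Maybe Monomial → (Monomial → ℚ) → (Monomial → ℚ) → ℚ
pullFrom nothing  w h = 0ℚ
pullFrom (just s) w h = h s ℚ.* w s

pull : Move → (Monomial → ℚ) → Monomial → ℚ
pull k h m = pullFrom (source k m) (weight k) h

D3ᶜ : (Monomial → ℚ) → Monomial → ℚ
D3ᶜ h m = pull x↑ h m ℚ.+ pull x↓ h m ℚ.+ pull z↑ h m ℚ.+ pull z↓ h m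

module _ (w : Monomial → ℚ) where

  pullFrom-+ : ∀ ms h₁ h₂ → pullFrom ms w (λ s → h₁ s ℚ.+ h₂ s) ≡ pullFrom ms w h₁ ℚ.+ pullFrom ms w h₂
  pullFrom-+ nothing  h₁ h₂ = refl
  pullFrom-+ (just s) h₁ h₂ = ℚP.*-distribʳ-+ (w s) (h₁ s) (h₂ s)

  pullFrom-cong : ∀ ms {h h′} → (∀ s → h s ≡ h′ s) → pullFrom ms w h ≡ pullFrom ms w h′
  pullFrom-cong nothing  e = refl
  pullFrom-cong (just s) e = cong (ℚ._* w s) (e s)

  pullFrom-zero : ∀ ms {h} → (∀ s → h s ≡ 0ℚ) → pullFrom ms w h ≡ 0ℚ
  pullFrom-zero nothing  e = refl
  pullFrom-zero (just s) e = trans (cong (ℚ._* w s) (e s)) (ℚP.*-zeroˡ (w s))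

  pullFrom-≢0 : ∀ ms {h} → pullFrom ms w h ≢ 0ℚ → ∃[ s ] ms ≡ just s × h s ≢ 0ℚ × w s ≢ 0ℚ
  pullFrom-≢0 nothing      nz = ⊥-elim (nz refl)
  pullFrom-≢0 (just s) {h} nz =
    s , refl , (λ e → nz (trans (cong (ℚ._* w s) e) (ℚP.*-zeroˡ (w s))))
             , (λ e → nz (trans (cong (h s ℚ.*_) e) (ℚP.*-zeroʳ (h s))))

D3ᶜ-+ : ∀ h₁ h₂ m → D3ᶜ (λ s → h₁ s ℚ.+ h₂ s) m ≡ D3ᶜ h₁ m ℚ.+ D3ᶜ h₂ m
D3ᶜ-+ h₁ h₂ m =
  trans (cong₂ ℚ._+_ (cong₂ ℚ._+_ (cong₂ ℚ._+_ (split x↑) (split x↓)) (split z↑)) (split z↓))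
        (interchange (P₁ x↑) (P₂ x↑) (P₁ x↓) (P₂ x↓) (P₁ z↑) (P₂ z↑) (P₁ z↓) (P₂ z↓))
  where
  P₁ P₂ : Move → ℚ
  P₁ k = pull k h₁ m
  P₂ k = pull k h₂ m
  split : ∀ k → pull k (λ s → h₁ s ℚ.+ h₂ s) m ≡ pull k h₁ m ℚ.+ pull k h₂ m
  split k = pullFrom-+ (weight k) (source k m) h₁ h₂
  interchange : ∀ a₁ a₂ b₁ b₂ c₁ c₂ d₁ d₂ →
    (a₁ ℚ.+ a₂) ℚ.+ (b₁ ℚ.+ b₂) ℚ.+ (c₁ ℚ.+ c₂) ℚ.+ (d₁ ℚ.+ d₂)
      ≡ (a₁ ℚ.+ b₁ ℚ.+ c₁ ℚ.+ d₁) ℚ.+ (a₂ ℚ.+ b₂ ℚ.+ c₂ ℚ.+ d₂)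
  interchange = RingSolver.solve-∀ ℚ-ring

D3ᶜ-cong : ∀ {h h′} → (∀ s → h s ≡ h′ s) → ∀ m → D3ᶜ h m ≡ D3ᶜ h′ m
D3ᶜ-cong {h} {h′} e m = cong₂ ℚ._+_ (cong₂ ℚ._+_ (cong₂ ℚ._+_ (by x↑) (by x↓)) (by z↑)) (by z↓)
  where
  by : ∀ k → pull k h m ≡ pull k h′ m
  by k = pullFrom-cong (weight k) (source k m) e

D3ᶜ-zero : ∀ {h} → (∀ s → h s ≡ 0ℚ) → ∀ m → D3ᶜ h m ≡ 0ℚ
D3ᶜ-zero {h} e m = cong₂ ℚ._+_ (cong₂ ℚ._+_ (cong₂ ℚ._+_ (by x↑) (by x↓)) (by z↑)) (by z↓)
  where
  by : ∀ k → pull k h m ≡ 0ℚ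
  by k = pullFrom-zero (weight k) (source k m) e

single-target : ∀ k s q m → single (target k s) (q ℚ.* weight k s) m ≡ pull k (single s q) m
single-target x↑ s q (zero , b , c) = refl
single-target x↑ s q (suc a , b , c) = single-scale s q (weight x↑) (a , b , c)
single-target x↓ s@(zero , b′ , c′) q m@(a , b , c) =
  trans (cong (λ v → single (target x↓ s) v m) (ℚP.*-zeroʳ q))
        (trans (single-zero (target x↓ s) m) (sym (ℚP.*-zeroˡ (weight x↓ (suc a , b - + 1 , c)))))
single-target x↓ s@(suc a′ , b′ , c′) q (a , b , c) =
  trans (single-shiftʸ a′ b′ c′ _ a b c (+ 1)) (single-scale s q (weight x↓) (suc a , b - + 1 , c))
single-target z↑ s q (a , b , zero) = single-other {target z↑ s} {a , b , zero} (q ℚ.* weight z↑ s) λ ()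
single-target z↑ s@(a′ , b′ , c′) q (a , b , suc c) =
  trans (single-shiftʸ a′ b′ c′ _ a b c (- + 1)) (single-scale s q (weight z↑) (a , b + + 1 , c))
single-target z↓ s@(a′ , b′ , zero) q m@(a , b , c) =
  trans (cong (λ v → single (target z↓ s) v m) (ℚP.*-zeroʳ q))
        (trans (single-zero (target z↓ s) m)
               (sym (trans (cong (ℚ._* w) (single-other {s} {a , b - + 2 , suc c} q λ ())) (ℚP.*-zeroˡ w))))
  where w = weight z↓ (a , b - + 2 , suc c)
single-target z↓ s@(a′ , b′ , suc c′) q (a , b , c) =
  trans (single-shiftʸ a′ b′ c′ _ a b c (+ 2)) (single-scale s q (weight z↓) (a , b - + 2 , suc c))

coeff-D3-term : ∀ t m → coeffᵐ (D3-term t) m ≡ D3ᶜ (single (monomial t) (Term.coef t)) m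
coeff-D3-term t@(term q a b c) m = begin
    coeffᵐ (D3-term t) m
  ≡⟨ coeff-sum (D3-term t) m ⟩
    δ x↑ c₁ ℚ.+ (δ x↓ c₂ ℚ.+ (δ x↑ c₃ ℚ.+ (δ z↑ c₄ ℚ.+ (δ x↑ c₅ ℚ.+ (δ z↓ c₆ ℚ.+ (δ z↑ c₇ ℚ.+ 0ℚ))))))
  ≡⟨ regroup (δ x↑ c₁) (δ x↓ c₂) (δ x↑ c₃) (δ z↑ c₄) (δ x↑ c₅) (δ z↓ c₆) (δ z↑ c₇) ⟩
    (δ x↑ c₁ ℚ.+ δ x↑ c₃ ℚ.+ δ x↑ c₅) ℚ.+ δ x↓ c₂ ℚ.+ (δ z↑ c₄ ℚ.+ δ z↑ c₇) ℚ.+ δ z↓ c₆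
  ≡⟨ cong₂ ℚ._+_ (cong₂ ℚ._+_ (cong₂ ℚ._+_ merge-x↑ refl) (single-+ (target z↑ s) c₄ c₇ m)) refl ⟩
    δ x↑ (c₁ ℚ.+ c₃ ℚ.+ c₅) ℚ.+ δ x↓ c₂ ℚ.+ δ z↑ (c₄ ℚ.+ c₇) ℚ.+ δ z↓ c₆
  ≡⟨ cong₂ ℚ._+_ (cong₂ ℚ._+_ (cong₂ ℚ._+_ (move x↑ (coef-x↑ q A B C k₆ k₂₃))
                                           (move x↓ (coef-neg q A k₆)))
                              (move z↑ (coef-z↑ q B C k₂₃ k₁₂)))
                 (move z↓ (coef-neg q C k₁₂)) ⟩
    D3ᶜ (single s q) m
  ∎
  where
  open ≡-Reasoning
  s = monomial t
  A = ℕtoℚ a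
  B = ℤtoℚ b
  C = ℕtoℚ c
  k₆ k₂₃ k₁₂ : ℚ
  k₆  = + 1 / 6
  k₂₃ = + 2 / 3
  k₁₂ = + 1 / 2
  c₁ = (q ℚ.* A) ℚ.* k₆
  c₂ = ℚ.- ((q ℚ.* A) ℚ.* k₆)
  c₃ = (q ℚ.* B) ℚ.* k₂₃
  c₄ = ℚ.- ((q ℚ.* B) ℚ.* k₂₃)
  c₅ = q ℚ.* C
  c₆ = ℚ.- ((q ℚ.* C) ℚ.* k₁₂)
  c₇ = ℚ.- ((q ℚ.* C) ℚ.* k₁₂)
  δ : Move → ℚ → ℚ
  δ k v = single (target k s) v m
  merge-x↑ : δ x↑ c₁ ℚ.+ δ x↑ c₃ ℚ.+ δ x↑ c₅ ≡ δ x↑ (c₁ ℚ.+ c₃ ℚ.+ c₅)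
  merge-x↑ = trans (cong (ℚ._+ δ x↑ c₅) (single-+ (target x↑ s) c₁ c₃ m))
                   (single-+ (target x↑ s) (c₁ ℚ.+ c₃) c₅ m)
  move : ∀ k {v} → v ≡ q ℚ.* weight k s → δ k v ≡ pull k (single s q) m
  move k e = trans (cong (δ k) e) (single-target k s q m)
  regroup : ∀ x₁ x₂ x₃ x₄ x₅ x₆ x₇ →
    x₁ ℚ.+ (x₂ ℚ.+ (x₃ ℚ.+ (x₄ ℚ.+ (x₅ ℚ.+ (x₆ ℚ.+ (x₇ ℚ.+ 0ℚ))))))
      ≡ (x₁ ℚ.+ x₃ ℚ.+ x₅) ℚ.+ x₂ ℚ.+ (x₄ ℚ.+ x₇) ℚ.+ x₆
  regroup = RingSolver.solve-∀ ℚ-ring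
  coef-x↑ : ∀ q A B C u v → (q ℚ.* A) ℚ.* u ℚ.+ (q ℚ.* B) ℚ.* v ℚ.+ q ℚ.* C
                              ≡ q ℚ.* (A ℚ.* u ℚ.+ B ℚ.* v ℚ.+ C)
  coef-x↑ = RingSolver.solve-∀ ℚ-ring
  coef-z↑ : ∀ q B C u v → ℚ.- ((q ℚ.* B) ℚ.* u) ℚ.+ ℚ.- ((q ℚ.* C) ℚ.* v)
                            ≡ q ℚ.* (ℚ.- (B ℚ.* u) ℚ.+ ℚ.- (C ℚ.* v))
  coef-z↑ = RingSolver.solve-∀ ℚ-ring
  coef-neg : ∀ q A u → ℚ.- ((q ℚ.* A) ℚ.* u) ≡ q ℚ.* ℚ.- (A ℚ.* u)
  coef-neg = RingSolver.solve-∀ ℚ-ring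

coeff-D3 : ∀ p m → coeffᵐ (D3 p) m ≡ D3ᶜ (coeffᵐ p) m
coeff-D3 [] m@(a , b , c) = sym (D3ᶜ-zero (λ { (a , b , c) → refl }) m)
coeff-D3 (t ∷ p) m = begin
  coeffᵐ (D3-term t ++ D3 p) m                    ≡⟨ coeff-++ (D3-term t) (D3 p) m ⟩
  coeffᵐ (D3-term t) m ℚ.+ coeffᵐ (D3 p) m        ≡⟨ cong₂ ℚ._+_ (coeff-D3-term t m) (coeff-D3 p m) ⟩
  D3ᶜ δ m ℚ.+ D3ᶜ (coeffᵐ p) m                    ≡⟨ D3ᶜ-+ δ (coeffᵐ p) m ⟨
  D3ᶜ (λ s → δ s ℚ.+ coeffᵐ p s) m                ≡⟨ D3ᶜ-cong (λ s → sym (coeff-∷ t p s)) m ⟩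
  D3ᶜ (coeffᵐ (t ∷ p)) m                          ∎
  where
  open ≡-Reasoning
  δ = single (monomial t) (Term.coef t)

weightedDegree : Monomial → ℤ
weightedDegree (a , b , c) = + a + + 2 * b + + 3 * + c

-- 3ν − 2(λ − r) with λ = a − 1, ν = −c, as in part (a).
gap : ℕ → Monomial → ℤ
gap r (a , _ , c) = (+ 3) * (- (+ c)) - (+ 2) * ((+ a - + 1) - + r)

Admissible : ℕ → Monomial → Set
Admissible r m = weightedDegree m ≡ + suc r × + 0 ≤ gap r m

gap-on-degree : ∀ r a b c → weightedDegree (a , b , c) ≡ + suc r →
                gap r (a , b , c) ≡ + 4 * b + + 3 * + c
gap-on-degree r a b c = ≡-modulo (- + 2) (identity (+ a) b (+ c) (+ r))
  where
  identity : ∀ a b c r → (+ 3) * (- c) - (+ 2) * ((a - + 1) - r)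
                         ≡ + 4 * b + + 3 * c + - + 2 * ((a + + 2 * b + + 3 * c) - (+ 1 + r))
  identity = solve-∀

weight-z↑-vanishes : ∀ a b c → + 4 * b + + 3 * + c ≡ + 0 → weight z↑ (a , b , c) ≡ 0ℚ
weight-z↑-vanishes a b c e = begin
  weight z↑ (a , b , c)                                        ≡⟨ identity (ℤtoℚ b) (ℕtoℚ c) ⟩
  ℚ.- (+ 1 / 6) ℚ.* (ℤtoℚ (+ 4) ℚ.* ℤtoℚ b ℚ.+ ℤtoℚ (+ 3) ℚ.* ℕtoℚ c)
    ≡⟨ cong (ℚ.- (+ 1 / 6) ℚ.*_) (cong₂ ℚ._+_ (ℤtoℚ-* (+ 4) b) (ℤtoℚ-* (+ 3) (+ c))) ⟨
  ℚ.- (+ 1 / 6) ℚ.* (ℤtoℚ (+ 4 * b) ℚ.+ ℤtoℚ (+ 3 * + c))      ≡⟨ cong (ℚ.- (+ 1 / 6) ℚ.*_) (ℤtoℚ-+ (+ 4 * b) (+ 3 * + c)) ⟨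
  ℚ.- (+ 1 / 6) ℚ.* ℤtoℚ (+ 4 * b + + 3 * + c)                ≡⟨ cong (λ x → ℚ.- (+ 1 / 6) ℚ.* ℤtoℚ x) e ⟩
  0ℚ                                                           ∎
  where
  open ≡-Reasoning
  identity : ∀ B C → ℚ.- (B ℚ.* (+ 2 / 3)) ℚ.+ ℚ.- (C ℚ.* (+ 1 / 2))
                     ≡ ℚ.- (+ 1 / 6) ℚ.* (ℤtoℚ (+ 4) ℚ.* B ℚ.+ ℤtoℚ (+ 3) ℚ.* C)
  identity = RingSolver.solve-∀ ℚ-ring

degree-source : ∀ k {s m} → source k m ≡ just s → weightedDegree m ≡ + 1 + weightedDegree s
degree-source x↑ {m = suc a , b , c} refl = identity (+ a) b (+ c)
  where
  identity : ∀ a b c → (+ 1 + a) + + 2 * b + + 3 * c ≡ + 1 + (a + + 2 * b + + 3 * c)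
  identity = solve-∀
degree-source x↓ {m = a , b , c} refl = identity (+ a) b (+ c)
  where
  identity : ∀ a b c → a + + 2 * b + + 3 * c ≡ + 1 + ((+ 1 + a) + + 2 * (b - + 1) + + 3 * c)
  identity = solve-∀
degree-source z↑ {m = a , b , suc c} refl = identity (+ a) b (+ c)
  where
  identity : ∀ a b c → a + + 2 * b + + 3 * (+ 1 + c) ≡ + 1 + (a + + 2 * (b + + 1) + + 3 * c)
  identity = solve-∀
degree-source z↓ {m = a , b , c} refl = identity (+ a) b (+ c)
  where
  identity : ∀ a b c → a + + 2 * b + + 3 * c ≡ + 1 + (a + + 2 * (b - + 2) + + 3 * (+ 1 + c))
  identity = solve-∀

gap-change : Move → ℤ
gap-change x↑ = + 0
gap-change x↓ = + 4
gap-change z↑ = - + 1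
gap-change z↓ = + 5

gap-source : ∀ k {r s m} → source k m ≡ just s → gap (suc r) m ≡ gap r s + gap-change k
gap-source x↑ {r} {m = suc a , b , c} refl = identity (+ a) (+ c) (+ r)
  where
  identity : ∀ a c r → (+ 3) * (- c) - (+ 2) * (((+ 1 + a) - + 1) - (+ 1 + r))
                       ≡ (+ 3) * (- c) - (+ 2) * ((a - + 1) - r) + + 0
  identity = solve-∀
gap-source x↓ {r} {m = a , b , c} refl = identity (+ a) (+ c) (+ r)
  where
  identity : ∀ a c r → (+ 3) * (- c) - (+ 2) * ((a - + 1) - (+ 1 + r))
                       ≡ (+ 3) * (- c) - (+ 2) * (((+ 1 + a) - + 1) - r) + + 4
  identity = solve-∀
gap-source z↑ {r} {m = a , b , suc c} refl = identity (+ a) (+ c) (+ r)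
  where
  identity : ∀ a c r → (+ 3) * (- (+ 1 + c)) - (+ 2) * ((a - + 1) - (+ 1 + r))
                       ≡ (+ 3) * (- c) - (+ 2) * ((a - + 1) - r) + - + 1
  identity = solve-∀
gap-source z↓ {r} {m = a , b , c} refl = identity (+ a) (+ c) (+ r)
  where
  identity : ∀ a c r → (+ 3) * (- c) - (+ 2) * ((a - + 1) - (+ 1 + r))
                       ≡ (+ 3) * (- (+ 1 + c)) - (+ 2) * ((a - + 1) - r) + + 5
  identity = solve-∀

gap-change-nonneg : ∀ k {r s} → weight k s ≢ 0ℚ → weightedDegree s ≡ + suc r →
                    + 0 ≤ gap r s → + 0 ≤ gap r s + gap-change k
gap-change-nonneg x↑ _ _ g = ℤP.+-mono-≤ g (+≤+ z≤n)
gap-change-nonneg x↓ _ _ g = ℤP.+-mono-≤ g (+≤+ z≤n)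
gap-change-nonneg z↓ _ _ g = ℤP.+-mono-≤ g (+≤+ z≤n)
gap-change-nonneg z↑ {r} {a , b , c} w≢0 d g =
  subst (+ 0 ≤_) (ℤP.+-comm (- + 1) (gap r (a , b , c)))
        (ℤP.i<j⇒i≤pred[j] (ℤP.≤∧≢⇒< g off-boundary))
  where
  off-boundary : + 0 ≢ gap r (a , b , c)
  off-boundary 0≡gap =
    w≢0 (weight-z↑-vanishes a b c (trans (sym (gap-on-degree r a b c d)) (sym 0≡gap)))

admissible-step : ∀ k {r s m} → source k m ≡ just s → weight k s ≢ 0ℚ →
                  Admissible r s → Admissible (suc r) m
admissible-step k src w≢0 (d , g) =
  trans (degree-source k src) (cong (_+_ (+ 1)) d) ,
  subst (+ 0 ≤_) (sym (gap-source k src)) (gap-change-nonneg k w≢0 d g)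

D3ᶜ-≢0 : ∀ h m → D3ᶜ h m ≢ 0ℚ → ∃[ k ] pull k h m ≢ 0ℚ
D3ᶜ-≢0 h m nz with +-≢0 nz
... | inj₂ p = z↓ , p
... | inj₁ nz′ with +-≢0 nz′
...   | inj₂ p = z↑ , p
...   | inj₁ nz″ with +-≢0 nz″
...     | inj₁ p = x↑ , p
...     | inj₂ p = x↓ , p

admissible-X : ∀ m → coeffᵐ X m ≢ 0ℚ → Admissible 0 m
admissible-X m nz
  with single-support (1 , + 0 , 0) 1ℚ m
         (λ e → nz (trans (coeff-sum X m) (trans (ℚP.+-identityʳ _) e)))
... | refl = refl , +≤+ z≤n

support-admissible : ∀ r m → coeffᵐ (D3^ r X) m ≢ 0ℚ → Admissible r m
support-admissible zero    m nz = admissible-X m nz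
support-admissible (suc r) m nz =
  let k , pull≢0           = D3ᶜ-≢0 (coeffᵐ (D3^ r X)) m (nz ∘ trans (coeff-D3 (D3^ r X) m))
      s , src , h≢0 , w≢0 = pullFrom-≢0 (weight k) (source k m) pull≢0
  in admissible-step k {r} {s} {m} src w≢0 (support-admissible r s h≢0)

admissible⇒bounds : ∀ r a b c → Admissible r (a , b , c) →
    ((+ 2) * ((+ a - + 1) - + r) ≤ (+ 3) * (- (+ c)))
    × ((+ 0) ≤ (+ 4) * b + (+ 3) * (+ c))
    × (- (+ r + + 1) ≤ (+ 2) * b)
admissible⇒bounds r a b c (d , g) =
  ℤP.0≤i-j⇒j≤i g ,
  subst (+ 0 ≤_) (gap-on-degree r a b c d) g ,
  ℤP.0≤i-j⇒j≤i (subst (+ 0 ≤_) (sym (≡-modulo (+ 1) (identity (+ a) b (+ c) (+ r)) d))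
                                (ℤP.+-mono-≤ g (+≤+ z≤n)))
  where
  identity : ∀ a b c r → (+ 2) * b - - (r + + 1)
                         ≡ (+ 3) * (- c) - (+ 2) * ((a - + 1) - r) + a
                           + + 1 * ((a + + 2 * b + + 3 * c) - (+ 1 + r))
  identity = solve-∀

lemma4p3 : (r a : ℕ) (b : ℤ) (c : ℕ) → coeff (D3^ r X) a b c ≢ 0ℚ →
    ((+ 2) * ((+ a - + 1) - + r) ≤ (+ 3) * (- (+ c)))
    × ((+ 0) ≤ (+ 4) * b + (+ 3) * (+ c))
    × (- (+ r + + 1) ≤ (+ 2) * b)
lemma4p3 r a b c nz = admissible⇒bounds r a b c (support-admissible r (a , b , c) nz)
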